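{- Let $p$ be a prime and let $e\le f$ be nonnegative integers, and set $q=p^f$. Then \[ \binom{q}{k}\equiv(-1)^{k-1}\frac{q}{k}\pmod{p^{2f-2e+2}} \] for all integers $k$ with $0<k<p^e$. Furthermore, if $p>2$ and $e<f$, the same congruence holds for all integers $k$ with $0<k<p^e+p^{e-1}$.
   Context: Congruences between rational numbers with denominators prime to $p$ are taken in $\mathbb{Z}_{(p)}$ (i.e., the difference lies in $p^m\mathbb{Z}_{(p)}$). -}

module Defs where

open import Data.Nat as ℕ using (ℕ; _<_)
open import Data.Nat.Divisibility using (_∣_)
open import Data.Nat.Base using (>-nonZero)
open import Data.Integer as ℤ using (ℤ; +_)
open import Data.Rational as ℚ using (ℚ)
open import Data.Product using (Σ; _×_)
open import Relation.Nullary using (¬_)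
open import Relation.Binary.PropositionalEquality using (_≡_)

ℕ→ℚ : ℕ → ℚ
ℕ→ℚ n = (+ n) ℚ./ 1

ℤ→ℚ : ℤ → ℚ
ℤ→ℚ z = z ℚ./ 1

-- x ∈ p^m ℤ_(p): there is d with p ∤ d and an integer n with x * d = p^m * n.
InPowZp : ℕ → ℕ → ℚ → Set
InPowZp p m x =
  Σ ℕ λ d → ¬ (p ∣ d) × Σ ℤ λ n → x ℚ.* ℕ→ℚ d ≡ ℕ→ℚ (p ℕ.^ m) ℚ.* ℤ→ℚ n

CongZp : ℕ → ℕ → ℚ → ℚ → Set
CongZp p m x y = InPowZp p m (x ℚ.- y)

frac : ℤ → (k : ℕ) → 0 < k → ℚ
frac z k k>0 = ℚ._/_ z k {{>-nonZero k>0}}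

{-# OPTIONS --safe #-}
-- Write q = p ^ f and A j = C(q,j) - C(q,j-1) + ... ± C(q,1) for the alternating sum of the
-- binomial coefficients. Pascal's rule gives C(q-1,j) = (-1)^j + A j, and together with
-- k C(q,k) = q C(q-1,k-1) this yields k C(q,k) - (-1)^(k-1) q = q A (k-1); so the congruence
-- modulo p^(2(f-e)+2) amounts to a lower bound for v_p (A (k-1)) in terms of v_p k.
-- The identity k C(q,k) = q C(q-1,k-1) also shows p^(f-c) ∣ C(q,i) whenever p^(c+1) ∤ i, which
-- bounds A (k-1) termwise; this suffices for k < p^e, and for p^e < k < p^e + p^(e-1), where
-- v_p k ≤ e-2. For k = p^e one more factor of p is needed: pairing i with p^e - i shows
-- C(q,i) ≡ C(q,p^e-i) modulo p^(f-e+2), and as p^e - 1 is even (p odd) the alternating sum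
-- A (p^e - 1) is then congruent to its own negative.
module Submission where

open import Data.Nat.Base using (ℕ)
open import Data.Nat.Primality using (Prime)

module Alternating where
  open import Data.Nat.Base as ℕ using (ℕ; zero; suc; _<_)
  open import Data.Nat.Properties as ℕ using (≤-refl; m<n⇒m<1+n; +-identityʳ; +-suc)
  open import Data.Nat.Divisibility as ℕ using (_∤_; ∣-refl; ∣m∣n⇒∣m+n)
  open import Data.Integer.Base using (ℤ; +_; 0ℤ; 1ℤ; -1ℤ; _+_; _-_; _*_; -_; _^_)
  open import Data.Integer.Properties
    using (-1*i≡-i; ^-distribˡ-+-*; ^-*-assoc; *-identityˡ; *-assoc; *-comm; neg-involutive)
  open import Data.Integer.Divisibility.Signed using (_∣_; divides; ∣m∣n⇒∣m-n; ∣n⇒∣m*n)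
  open import Data.Integer.Tactic.RingSolver using (solve-∀)
  open import Relation.Nullary using (contradiction)
  open import Relation.Binary.PropositionalEquality

  sign : ℕ → ℤ
  sign n = -1ℤ ^ n

  sign-suc : ∀ n → sign (suc n) ≡ - sign n
  sign-suc n = -1*i≡-i (sign n)

  sign-+ : ∀ m n → sign (m ℕ.+ n) ≡ sign m * sign n
  sign-+ = ^-distribˡ-+-* -1ℤ

  sign-suc-suc : ∀ n → sign (suc (suc n)) ≡ sign n
  sign-suc-suc n = trans (sign-suc (suc n)) (trans (cong -_ (sign-suc n)) (neg-involutive (sign n)))

  sign*sign≡1 : ∀ n → sign n * sign n ≡ 1ℤ
  sign*sign≡1 n = trans (sym (sign-+ n n)) (sign-even n)
    where
    sign-even : ∀ n → sign (n ℕ.+ n) ≡ 1ℤ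
    sign-even zero = refl
    sign-even (suc n) =
      trans (cong (λ m → sign (suc m)) (+-suc n n)) (trans (sign-suc-suc (n ℕ.+ n)) (sign-even n))

  sign-odd : ∀ n → 2 ∤ n → sign n ≡ -1ℤ
  sign-odd zero 2∤0 = contradiction (ℕ.divides 0 refl) 2∤0
  sign-odd (suc zero) _ = refl
  sign-odd (suc (suc n)) 2∤n+2 =
    trans (sign-suc-suc n) (sign-odd n (λ 2∣n → 2∤n+2 (∣m∣n⇒∣m+n ∣-refl 2∣n)))

  sign-*ˡ : ∀ m n → sign m ≡ -1ℤ → sign (m ℕ.* n) ≡ sign n
  sign-*ˡ m n odd = trans (sym (^-*-assoc -1ℤ m n)) (cong (_^ n) odd)

  sign-pred : ∀ {n s} → sign (suc n) ≡ - s → sign n ≡ s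
  sign-pred {n} {s} h =
    trans (sym (neg-involutive (sign n))) (trans (cong -_ (trans (sym (sign-suc n)) h)) (neg-involutive s))

  sign-complement : ∀ m n → sign (suc (m ℕ.+ n)) ≡ 1ℤ → sign n ≡ - sign m
  sign-complement m n even = begin
    sign n                      ≡⟨ sym (*-identityˡ (sign n)) ⟩
    1ℤ * sign n                 ≡⟨ cong (_* sign n) (sym (sign*sign≡1 m)) ⟩
    sign m * sign m * sign n    ≡⟨ *-assoc (sign m) (sign m) (sign n) ⟩
    sign m * (sign m * sign n)  ≡⟨ cong (sign m *_) (sym (sign-+ m n)) ⟩
    sign m * sign (m ℕ.+ n)     ≡⟨ cong (sign m *_) (sign-pred {m ℕ.+ n} even) ⟩
    sign m * -1ℤ                ≡⟨ *-comm (sign m) -1ℤ ⟩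
    -1ℤ * sign m                ≡⟨ -1*i≡-i (sign m) ⟩
    - sign m                    ∎
    where open ≡-Reasoning

  alternating : (ℕ → ℤ) → ℕ → ℤ
  alternating a zero = 0ℤ
  alternating a (suc j) = a (suc j) - alternating a j

  ∣-alternating : ∀ {d} a j → (∀ {i} → i < j → d ∣ a (suc i)) → d ∣ alternating a j
  ∣-alternating a zero _ = divides 0ℤ refl
  ∣-alternating a (suc j) d∣a = ∣m∣n⇒∣m-n (d∣a ≤-refl) (∣-alternating a j (λ i<j → d∣a (m<n⇒m<1+n i<j)))

  alternating-reflect : ∀ {d} a n → sign n ≡ 1ℤ →
    (∀ i i′ → suc i ℕ.+ suc i′ ≡ suc n → d ∣ a (suc i) - a (suc i′)) →
    d ∣ + 2 * alternating a n
  alternating-reflect {d} a n even symmetric =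
    subst (d ∣_) (trans (cong (λ s → s * A n + A n - 1ℤ * 0ℤ) even) (double (A n)))
      (invariant n 0 (+-identityʳ n))
    where
    A : ℕ → ℤ
    A = alternating a
    double : ∀ x → 1ℤ * x + x - 1ℤ * 0ℤ ≡ + 2 * x
    double = solve-∀
    -- As n is even, the right-hand side equals the sum over i ≤ j of (-1)^i (a i - a (n+1-i)).
    invariant : ∀ j l → j ℕ.+ l ≡ n → d ∣ sign j * A j + A n - sign l * A l
    invariant zero l refl =
      subst (d ∣_) (sym (trans (cong (λ s → 1ℤ * 0ℤ + A l - s * A l) even) (cancel (A l)))) (divides 0ℤ refl)
      where
      cancel : ∀ x → 1ℤ * 0ℤ + x - 1ℤ * x ≡ 0ℤ
      cancel = solve-∀
    invariant (suc j) l j+l+1≡n =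
      subst (d ∣_) (sym step) (∣m∣n⇒∣m-n (invariant j (suc l) j+[l+1]≡n)
                                          (∣n⇒∣m*n (sign j) (symmetric j l (cong suc j+[l+1]≡n))))
      where
      j+[l+1]≡n : j ℕ.+ suc l ≡ n
      j+[l+1]≡n = trans (+-suc j l) j+l+1≡n
      step : sign (suc j) * A (suc j) + A n - sign l * A l
           ≡ (sign j * A j + A n - sign (suc l) * A (suc l)) - sign j * (a (suc j) - a (suc l))
      step rewrite sign-suc j | sign-suc l | sign-complement j l (trans (cong sign j+l+1≡n) even) =
        regroup (sign j) (a (suc j)) (a (suc l)) (A j) (A l) (A n)
        where
        regroup : ∀ s x y u v w → - s * (x - u) + w - - s * v ≡ (s * u + w - - - s * (y - v)) - s * (x - y)
        regroup = solve-∀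

module Binomial where
  open import Data.Nat.Base as ℕ using (ℕ; zero; suc)
  open import Data.Nat.Properties as ℕ using (*-zeroʳ; *-identityˡ)
  open import Data.Nat.Combinatorics using (_C_; nC1≡n; nCk+nC[k+1]≡[n+1]C[k+1])
  open import Data.Nat.Divisibility as ℕ using (m∣m*n; ∣-refl)
  import Data.Nat.Tactic.RingSolver as ℕ-Solver
  open import Data.Integer.Base using (ℤ; +_; _+_; _-_; _*_; -_)
  import Data.Integer.Properties as ℤ
  open import Data.Integer.Tactic.RingSolver using (solve-∀)
  open import Relation.Binary.PropositionalEquality
  open Alternating

  [k+1]*[n+1]C[k+1]≡[n+1]*nCk : ∀ n k → suc k ℕ.* (suc n C suc k) ≡ suc n ℕ.* (n C k)
  [k+1]*[n+1]C[k+1]≡[n+1]*nCk zero zero = refl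
  [k+1]*[n+1]C[k+1]≡[n+1]*nCk zero (suc k) = *-zeroʳ (suc (suc k))
  [k+1]*[n+1]C[k+1]≡[n+1]*nCk (suc n) zero =
    trans (*-identityˡ _) (trans (nC1≡n (suc (suc n))) (sym (ℕ.*-identityʳ _)))
  [k+1]*[n+1]C[k+1]≡[n+1]*nCk (suc n) (suc k) = begin
    suc (suc k) ℕ.* (suc (suc n) C suc (suc k))
      ≡⟨ cong (suc (suc k) ℕ.*_) (sym (nCk+nC[k+1]≡[n+1]C[k+1] (suc n) (suc k))) ⟩
    suc (suc k) ℕ.* (X ℕ.+ Y)
      ≡⟨ regroup k X Y ⟩
    X ℕ.+ (suc k ℕ.* X ℕ.+ suc (suc k) ℕ.* Y)
      ≡⟨ cong (X ℕ.+_) (cong₂ ℕ._+_ ([k+1]*[n+1]C[k+1]≡[n+1]*nCk n k)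
                                     ([k+1]*[n+1]C[k+1]≡[n+1]*nCk n (suc k))) ⟩
    X ℕ.+ (suc n ℕ.* (n C k) ℕ.+ suc n ℕ.* (n C suc k))
      ≡⟨ cong (X ℕ.+_) (sym (ℕ.*-distribˡ-+ (suc n) (n C k) (n C suc k))) ⟩
    X ℕ.+ suc n ℕ.* (n C k ℕ.+ n C suc k)
      ≡⟨ cong (λ z → X ℕ.+ suc n ℕ.* z) (nCk+nC[k+1]≡[n+1]C[k+1] n k) ⟩
    suc (suc n) ℕ.* X ∎
    where
    open ≡-Reasoning
    X = suc n C suc k
    Y = suc n C suc (suc k)
    regroup : ∀ k x y → suc (suc k) ℕ.* (x ℕ.+ y) ≡ x ℕ.+ (suc k ℕ.* x ℕ.+ suc (suc k) ℕ.* y)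
    regroup = ℕ-Solver.solve-∀

  m∣[k+1]*mC[k+1] : ∀ m k → m ℕ.∣ suc k ℕ.* (m C suc k)
  m∣[k+1]*mC[k+1] zero k = subst (0 ℕ.∣_) (sym (*-zeroʳ (suc k))) ∣-refl
  m∣[k+1]*mC[k+1] (suc n) k = subst (suc n ℕ.∣_) (sym ([k+1]*[n+1]C[k+1]≡[n+1]*nCk n k)) (m∣m*n (n C k))

  binom : ℕ → ℕ → ℤ
  binom m k = + (m C k)

  alternating-binom : ∀ n j → alternating (binom (suc n)) j ≡ binom n j - sign j
  alternating-binom n zero = refl
  alternating-binom n (suc j) = begin
    binom (suc n) (suc j) - alternating (binom (suc n)) j
      ≡⟨ cong₂ _-_ (cong +_ (sym (nCk+nC[k+1]≡[n+1]C[k+1] n j))) (alternating-binom n j) ⟩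
    + (n C j ℕ.+ n C suc j) - (binom n j - sign j)
      ≡⟨ cong (_- (binom n j - sign j)) (ℤ.pos-+ (n C j) (n C suc j)) ⟩
    binom n j + binom n (suc j) - (binom n j - sign j)
      ≡⟨ regroup (binom n j) (binom n (suc j)) (sign j) ⟩
    binom n (suc j) - - sign j
      ≡⟨ cong (λ s → binom n (suc j) - s) (sym (sign-suc j)) ⟩
    binom n (suc j) - sign (suc j) ∎
    where
    open ≡-Reasoning
    regroup : ∀ x y s → x + y - (x - s) ≡ y - - s
    regroup = solve-∀

  [k+1]*mC[k+1]-sign*m≡m*alternating : ∀ m k →
    + suc k * binom m (suc k) - sign k * + m ≡ + m * alternating (binom m) k
  [k+1]*mC[k+1]-sign*m≡m*alternating zero k = cong₂ _-_ (ℤ.*-zeroʳ (+ suc k)) (ℤ.*-zeroʳ (sign k))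
  [k+1]*mC[k+1]-sign*m≡m*alternating (suc n) k = begin
    + suc k * binom (suc n) (suc k) - sign k * + suc n
      ≡⟨ cong (_- sign k * + suc n) (sym (ℤ.pos-* (suc k) (suc n C suc k))) ⟩
    + (suc k ℕ.* (suc n C suc k)) - sign k * + suc n
      ≡⟨ cong (λ z → + z - sign k * + suc n) ([k+1]*[n+1]C[k+1]≡[n+1]*nCk n k) ⟩
    + (suc n ℕ.* (n C k)) - sign k * + suc n
      ≡⟨ cong (_- sign k * + suc n) (ℤ.pos-* (suc n) (n C k)) ⟩
    + suc n * binom n k - sign k * + suc n
      ≡⟨ regroup (+ suc n) (binom n k) (sign k) ⟩
    + suc n * (binom n k - sign k)
      ≡⟨ cong (+ suc n *_) (sym (alternating-binom n k)) ⟩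
    + suc n * alternating (binom (suc n)) k ∎
    where
    open ≡-Reasoning
    regroup : ∀ m x s → m * x - s * m ≡ m * (x - s)
    regroup = solve-∀

  binom-pair : ∀ m i i′ → sign i′ ≡ - sign i →
    + suc i * (binom m (suc i) - binom m (suc i′))
      ≡ + m * (alternating (binom m) i + alternating (binom m) i′) - + (suc i ℕ.+ suc i′) * binom m (suc i′)
  binom-pair m i i′ sign-i′≡-sign-i = begin
    + suc i * (x - y)
      ≡⟨ regroup (+ suc i) (+ suc i′) x y (sign i) (+ m) ⟩
    (+ suc i * x - sign i * + m) + (+ suc i′ * y - - sign i * + m) - (+ suc i + + suc i′) * y
      ≡⟨ cong₂ (λ u v → u + v - (+ suc i + + suc i′) * y)
               ([k+1]*mC[k+1]-sign*m≡m*alternating m i)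
               (trans (cong (λ s → + suc i′ * y - s * + m) (sym sign-i′≡-sign-i))
                      ([k+1]*mC[k+1]-sign*m≡m*alternating m i′)) ⟩
    + m * alternating (binom m) i + + m * alternating (binom m) i′ - (+ suc i + + suc i′) * y
      ≡⟨ cong₂ _-_ (sym (ℤ.*-distribˡ-+ (+ m) _ _)) (cong (_* y) (sym (ℤ.pos-+ (suc i) (suc i′)))) ⟩
    + m * (alternating (binom m) i + alternating (binom m) i′) - + (suc i ℕ.+ suc i′) * y ∎
    where
    open ≡-Reasoning
    x = binom m (suc i)
    y = binom m (suc i′)
    regroup : ∀ k k′ x y s m → k * (x - y) ≡ (k * x - s * m) + (k′ * y - - s * m) - (k + k′) * y
    regroup = solve-∀

module Fractions where
  open import Data.Nat.Base using (suc; _<_)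
  import Data.Nat.Properties as ℕ
  open import Data.Integer.Base using (+_; _+_; _-_; _*_; -_)
  open import Data.Integer.Tactic.RingSolver using (solve-∀)
  import Data.Rational as ℚ
  open import Data.Rational.Properties
    using (toℚᵘ-injective; toℚᵘ-homo-*; toℚᵘ-homo-+; toℚᵘ-homo‿-; toℚᵘ-fromℚᵘ)
  import Data.Rational.Unnormalised.Base as ℚᵘ
  open import Data.Rational.Unnormalised.Properties
    using (≃-trans; ≃-sym; *-cong; +-cong; -‿cong; module ≃-Reasoning)
  open import Relation.Binary.PropositionalEquality
  open import Defs

  [x-z/k]*u≡P*n : ∀ x z j u P n (k>0 : 0 < suc j) → (+ x * + suc j - z) * + u ≡ (+ P * n) * + suc j →
    (ℕ→ℚ x ℚ.- frac z (suc j) k>0) ℚ.* ℕ→ℚ u ≡ ℕ→ℚ P ℚ.* ℤ→ℚ n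
  [x-z/k]*u≡P*n x z j u P n k>0 eq = toℚᵘ-injective (begin
    ℚ.toℚᵘ ((ℕ→ℚ x ℚ.- z/k) ℚ.* ℕ→ℚ u)
      ≈⟨ toℚᵘ-homo-* (ℕ→ℚ x ℚ.- z/k) (ℕ→ℚ u) ⟩
    ℚ.toℚᵘ (ℕ→ℚ x ℚ.- z/k) ℚᵘ.* ℚ.toℚᵘ (ℕ→ℚ u)
      ≈⟨ *-cong (≃-trans (toℚᵘ-homo-+ (ℕ→ℚ x) (ℚ.- z/k))
                         (+-cong (toℚᵘ-fromℚᵘ (ℚᵘ.mkℚᵘ (+ x) 0))
                                 (≃-trans (toℚᵘ-homo‿- z/k) (-‿cong (toℚᵘ-fromℚᵘ (ℚᵘ.mkℚᵘ z j))))))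
                (toℚᵘ-fromℚᵘ (ℚᵘ.mkℚᵘ (+ u) 0)) ⟩
    (ℚᵘ.mkℚᵘ (+ x) 0 ℚᵘ.- ℚᵘ.mkℚᵘ z j) ℚᵘ.* ℚᵘ.mkℚᵘ (+ u) 0
      ≈⟨ ℚᵘ.*≡* (trans (regroup (+ x * + suc j) z (+ u))
                       (trans eq (cong (λ d → (+ P * n) * + d) (sym (trans (ℕ.*-identityʳ _) (ℕ.*-identityˡ _)))))) ⟩
    ℚᵘ.mkℚᵘ (+ P) 0 ℚᵘ.* ℚᵘ.mkℚᵘ n 0
      ≈⟨ ≃-sym (≃-trans (toℚᵘ-homo-* (ℕ→ℚ P) (ℤ→ℚ n))
                        (*-cong (toℚᵘ-fromℚᵘ (ℚᵘ.mkℚᵘ (+ P) 0)) (toℚᵘ-fromℚᵘ (ℚᵘ.mkℚᵘ n 0)))) ⟩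
    ℚ.toℚᵘ (ℕ→ℚ P ℚ.* ℤ→ℚ n) ∎)
    where
    open ≃-Reasoning
    z/k = frac z (suc j) k>0
    regroup : ∀ a b c → ((a + - b * + 1) * c) * + 1 ≡ (a - b) * c
    regroup = solve-∀

module PrimePowers {p : ℕ} (p-prime : Prime p) where
  open import Data.Nat.Base using (zero; suc; _+_; _*_; _^_; _<_; _≤_; z≤n; s≤s; NonZero; nonTrivial⇒n>1)
  open import Data.Nat.Properties as ℕ
    using (*-comm; +-comm; +-identityʳ; +-suc; <⇒≤; ≤-<-trans; m≤m+n; m<m+n; +-monoʳ-≤; *-monoˡ-≤; ^-distribˡ-+-*)
  open import Data.Nat.Divisibility
    using (_∣_; _∤_; divides; _∣?_; ∣-trans; ∣-refl; 1∣_; m∣m*n; *-monoʳ-∣; *-cancelˡ-∣; *-pres-∣; >⇒∤)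
  open import Data.Nat.Primality using (Prime; composite; euclidsLemma; prime⇒nonZero; prime⇒nonTrivial)
  open import Data.Nat.Combinatorics using (_C_)
  open import Data.Nat.Tactic.RingSolver using (solve-∀)
  open import Data.Integer.Base as ℤ using (+_; 0ℤ; -1ℤ)
  import Data.Integer.Properties as ℤ
  open import Data.Integer.Divisibility.Signed as ℤ using (∣ᵤ⇒∣; ∣⇒∣ᵤ)
  open import Data.Integer.Tactic.RingSolver renaming (solve-∀ to ℤ-solve-∀)
  open import Data.Product using (∃₂; _×_; _,_)
  open import Data.Sum using (inj₁; inj₂)
  open import Relation.Nullary using (yes; no; contradiction)
  open import Relation.Binary.PropositionalEquality
  open import Defs
  open Alternating
  open Binomial
  open Fractions

  instance
    p≢0 : NonZero p
    p≢0 = prime⇒nonZero p-prime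

  1<p : 1 < p
  1<p = nonTrivial⇒n>1 p {{prime⇒nonTrivial p-prime}}

  p^e+p^e≤p^[e+1] : ∀ e → p ^ e + p ^ e ≤ p ^ suc e
  p^e+p^e≤p^[e+1] e =
    subst (_≤ p ^ suc e) (cong (λ x → p ^ e + x) (+-identityʳ (p ^ e))) (*-monoˡ-≤ (p ^ e) 1<p)

  ^-monoʳ-∣ : ∀ {m n} → m ≤ n → p ^ m ∣ p ^ n
  ^-monoʳ-∣ {m} m≤n with ℕ.m≤n⇒∃[o]m+o≡n m≤n
  ... | o , refl = divides (p ^ o) (trans (^-distribˡ-+-* p m o) (*-comm (p ^ m) (p ^ o)))

  p^n∣i*x⇒p^n∣x : ∀ n {i x} → p ∤ i → p ^ n ∣ i * x → p ^ n ∣ x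
  p^n∣i*x⇒p^n∣x zero _ _ = 1∣ _
  p^n∣i*x⇒p^n∣x (suc n) {i} {x} p∤i p^[n+1]∣ix
    with euclidsLemma i x p-prime (∣-trans (m∣m*n (p ^ n)) p^[n+1]∣ix)
  ... | inj₁ p∣i = contradiction p∣i p∤i
  ... | inj₂ (divides x′ refl) = subst (p ^ suc n ∣_) (*-comm p x′)
        (*-monoʳ-∣ p (p^n∣i*x⇒p^n∣x n p∤i (*-cancelˡ-∣ p (subst (p ^ suc n ∣_) (regroup p i x′) p^[n+1]∣ix))))
    where
    regroup : ∀ p i x → i * (x * p) ≡ p * (i * x)
    regroup = solve-∀

  p^1∤i⇒p∤i : ∀ {i} → p ^ 1 ∤ i → p ∤ i
  p^1∤i⇒p∤i p^1∤i p∣i = p^1∤i (subst (_∣ _) (sym (ℕ.*-identityʳ p)) p∣i)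

  p^[c+1]∤i*p⇒p^c∤i : ∀ c {i} → p ^ suc c ∤ i * p → p ^ c ∤ i
  p^[c+1]∤i*p⇒p^c∤i c {i} p^[c+1]∤ip p^c∣i =
    p^[c+1]∤ip (subst (_∣ i * p) (*-comm (p ^ c) p) (*-pres-∣ p^c∣i ∣-refl))

  p^[t+c]∣i*x⇒p^t∣x : ∀ t c {i x} → p ^ suc c ∤ i → p ^ (t + c) ∣ i * x → p ^ t ∣ x
  p^[t+c]∣i*x⇒p^t∣x t c {i} p^[c+1]∤i p^[t+c]∣ix with p ∣? i
  ... | no p∤i = ∣-trans (^-monoʳ-∣ (m≤m+n t c)) (p^n∣i*x⇒p^n∣x (t + c) p∤i p^[t+c]∣ix)
  p^[t+c]∣i*x⇒p^t∣x t zero p^1∤i _ | yes p∣i = contradiction p∣i (p^1∤i⇒p∤i p^1∤i)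
  p^[t+c]∣i*x⇒p^t∣x t (suc c) {_} {x} p^[c+2]∤i p^[t+c+1]∣ix | yes (divides i′ refl) =
    p^[t+c]∣i*x⇒p^t∣x t c {i′} (p^[c+1]∤i*p⇒p^c∤i (suc c) p^[c+2]∤i)
      (*-cancelˡ-∣ p (subst₂ _∣_ (cong (p ^_) (+-suc t c)) (regroup p i′ x) p^[t+c+1]∣ix))
    where
    regroup : ∀ p i x → i * p * x ≡ p * (i * x)
    regroup = solve-∀

  factorise : ∀ c {k} → p ^ suc c ∤ k → ∃₂ λ a u → a ≤ c × k ≡ p ^ a * u × p ∤ u
  factorise c {k} p^[c+1]∤k with p ∣? k
  ... | no p∤k = 0 , k , z≤n , sym (+-identityʳ k) , p∤k
  factorise zero p^1∤k | yes p∣k = contradiction p∣k (p^1∤i⇒p∤i p^1∤k)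
  factorise (suc c) p^[c+2]∤k | yes (divides k′ refl)
    with factorise c {k′} (p^[c+1]∤i*p⇒p^c∤i (suc c) p^[c+2]∤k)
  ... | a , u , a≤c , refl , p∤u = suc a , u , s≤s a≤c , regroup p (p ^ a) u , p∤u
    where
    regroup : ∀ p q u → q * u * p ≡ p * q * u
    regroup = solve-∀

  p^t∣mC[k+1] : ∀ t c {m k} → p ^ (t + c) ∣ m → p ^ suc c ∤ suc k → p ^ t ∣ m C suc k
  p^t∣mC[k+1] t c {m} {k} p^[t+c]∣m p^[c+1]∤k+1 =
    p^[t+c]∣i*x⇒p^t∣x t c p^[c+1]∤k+1 (∣-trans p^[t+c]∣m (m∣[k+1]*mC[k+1] m k))

  +p^m∣⇒+p^n∣ : ∀ {m n x} → n ≤ m → + (p ^ m) ℤ.∣ x → + (p ^ n) ℤ.∣ x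
  +p^m∣⇒+p^n∣ n≤m = ℤ.∣-trans (∣ᵤ⇒∣ (^-monoʳ-∣ n≤m))

  +p^m∣∧+p^n∣⇒+p^[m+n]∣* : ∀ m n {x y} →
    + (p ^ m) ℤ.∣ x → + (p ^ n) ℤ.∣ y → + (p ^ (m + n)) ℤ.∣ x ℤ.* y
  +p^m∣∧+p^n∣⇒+p^[m+n]∣* m n {x} {y} p^m∣x p^n∣y =
    ∣ᵤ⇒∣ (subst₂ _∣_ (sym (^-distribˡ-+-* p m n)) (sym (ℤ.abs-* x y)) (*-pres-∣ (∣⇒∣ᵤ p^m∣x) (∣⇒∣ᵤ p^n∣y)))

  +p^[t+c]∣i*x⇒+p^t∣x : ∀ t c {i x} → p ^ suc c ∤ i → + (p ^ (t + c)) ℤ.∣ + i ℤ.* x → + (p ^ t) ℤ.∣ x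
  +p^[t+c]∣i*x⇒+p^t∣x t c {i} {x} p^[c+1]∤i p^[t+c]∣ix =
    ∣ᵤ⇒∣ (p^[t+c]∣i*x⇒p^t∣x t c p^[c+1]∤i (subst (_ ∣_) (ℤ.abs-* (+ i) x) (∣⇒∣ᵤ p^[t+c]∣ix)))

  +p^t∣alternating-binom : ∀ t c {m} j → p ^ (t + c) ∣ m → j < p ^ suc c →
    + (p ^ t) ℤ.∣ alternating (binom m) j
  +p^t∣alternating-binom t c j p^[t+c]∣m j<p^[c+1] =
    ∣-alternating (binom _) j (λ i<j → ∣ᵤ⇒∣ (p^t∣mC[k+1] t c p^[t+c]∣m (>⇒∤ (≤-<-trans i<j j<p^[c+1]))))

  congruence-from-∣ : ∀ M c x z j (k>0 : 0 < suc j) → p ^ suc c ∤ suc j →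
    + (p ^ (M + c)) ℤ.∣ + suc j ℤ.* + x ℤ.- z → CongZp p M (ℕ→ℚ x) (frac z (suc j) k>0)
  congruence-from-∣ M c x z j k>0 p^[c+1]∤k p^[M+c]∣kx-z with factorise c p^[c+1]∤k
  ... | a , u , a≤c , k≡p^a*u , p∤u with +p^m∣⇒+p^n∣ (+-monoʳ-≤ M a≤c) p^[M+c]∣kx-z
  ... | ℤ.divides n kx-z≡n*p^[M+a] = u , p∤u , n , [x-z/k]*u≡P*n x z j u (p ^ M) n k>0 cross-multiplied
    where
    open ≡-Reasoning
    regroup : ∀ n P Q u → n ℤ.* (P ℤ.* Q) ℤ.* u ≡ P ℤ.* n ℤ.* (Q ℤ.* u)
    regroup = ℤ-solve-∀
    cross-multiplied : (+ x ℤ.* + suc j ℤ.- z) ℤ.* + u ≡ (+ (p ^ M) ℤ.* n) ℤ.* + suc j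
    cross-multiplied = begin
      (+ x ℤ.* + suc j ℤ.- z) ℤ.* + u
        ≡⟨ cong (λ w → (w ℤ.- z) ℤ.* + u) (ℤ.*-comm (+ x) (+ suc j)) ⟩
      (+ suc j ℤ.* + x ℤ.- z) ℤ.* + u
        ≡⟨ cong (ℤ._* + u) kx-z≡n*p^[M+a] ⟩
      n ℤ.* + (p ^ (M + a)) ℤ.* + u
        ≡⟨ cong (λ w → n ℤ.* w ℤ.* + u) (trans (cong +_ (^-distribˡ-+-* p M a)) (ℤ.pos-* (p ^ M) (p ^ a))) ⟩
      n ℤ.* (+ (p ^ M) ℤ.* + (p ^ a)) ℤ.* + u
        ≡⟨ regroup n (+ (p ^ M)) (+ (p ^ a)) (+ u) ⟩
      + (p ^ M) ℤ.* n ℤ.* (+ (p ^ a) ℤ.* + u)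
        ≡⟨ cong (+ (p ^ M) ℤ.* n ℤ.*_) (trans (sym (ℤ.pos-* (p ^ a) u)) (cong +_ (sym k≡p^a*u))) ⟩
      + (p ^ M) ℤ.* n ℤ.* + suc j ∎

  module _ (2<p : 2 < p) where
    2∤p : 2 ∤ p
    2∤p 2∣p = Prime.notComposite p-prime (composite 2<p 2∣p)

    sign[p^e]≡-1 : ∀ e → sign (p ^ e) ≡ -1ℤ
    sign[p^e]≡-1 zero = refl
    sign[p^e]≡-1 (suc e) = trans (sign-*ˡ p (p ^ e) (sign-odd p 2∤p)) (sign[p^e]≡-1 e)

    +p^[2+t]∣binom-pair : ∀ t c {m} i i′ → p ^ (suc t + c) ∣ m → suc i + suc i′ ≡ p ^ suc c →
      + (p ^ (2 + t)) ℤ.∣ binom m (suc i) ℤ.- binom m (suc i′)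
    +p^[2+t]∣binom-pair t c {m} i i′ p^[t+1+c]∣m k+k′≡N =
      +p^[t+c]∣i*x⇒+p^t∣x (2 + t) c (>⇒∤ k<N)
        (subst (+ (p ^ (2 + t + c)) ℤ.∣_) (sym (binom-pair m i i′ sign-i′≡-sign-i))
          (ℤ.∣m∣n⇒∣m-n m-term N-term))
      where
      N = p ^ suc c
      k<N : suc i < N
      k<N = subst (suc i <_) k+k′≡N (m<m+n (suc i) (s≤s z≤n))
      k′<N : suc i′ < N
      k′<N = subst (suc i′ <_) (trans (+-comm (suc i′) (suc i)) k+k′≡N) (m<m+n (suc i′) (s≤s z≤n))
      sign-i′≡-sign-i : sign i′ ≡ ℤ.- sign i
      sign-i′≡-sign-i = sign-complement i i′ (sign-pred {suc (i + i′)}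
        (trans (cong sign (trans (cong suc (sym (+-suc i i′))) k+k′≡N)) (sign[p^e]≡-1 (suc c))))
      +p^[t+1]∣alternating : ∀ {j} → suc j < N → + (p ^ suc t) ℤ.∣ alternating (binom m) j
      +p^[t+1]∣alternating {j} j+1<N = +p^t∣alternating-binom (suc t) c j p^[t+1+c]∣m (<⇒≤ j+1<N)
      m-term : + (p ^ (2 + t + c)) ℤ.∣ + m ℤ.* (alternating (binom m) i ℤ.+ alternating (binom m) i′)
      m-term = +p^m∣⇒+p^n∣ (m<m+n (suc t + c) (s≤s z≤n))
        (+p^m∣∧+p^n∣⇒+p^[m+n]∣* (suc t + c) (suc t) {+ m} (∣ᵤ⇒∣ p^[t+1+c]∣m)
          (ℤ.∣m∣n⇒∣m+n (+p^[t+1]∣alternating k<N) (+p^[t+1]∣alternating k′<N)))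
      N-term : + (p ^ (2 + t + c)) ℤ.∣ + (suc i + suc i′) ℤ.* binom m (suc i′)
      N-term = subst₂ (λ e K → + (p ^ e) ℤ.∣ + K ℤ.* binom m (suc i′)) (exponent c t) (sym k+k′≡N)
        (+p^m∣∧+p^n∣⇒+p^[m+n]∣* (suc c) (suc t) ℤ.∣-refl
          (∣ᵤ⇒∣ (p^t∣mC[k+1] (suc t) c p^[t+1+c]∣m (>⇒∤ k′<N))))
        where
        exponent : ∀ c t → suc c + suc t ≡ 2 + t + c
        exponent = solve-∀

    +p^[2+t]∣alternating-binom : ∀ t e {m n} → p ^ (t + e) ∣ m → suc n ≡ p ^ e →
      + (p ^ (2 + t)) ℤ.∣ alternating (binom m) n
    +p^[2+t]∣alternating-binom t zero _ refl = ℤ.divides 0ℤ refl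
    +p^[2+t]∣alternating-binom t (suc c) {m} {n} p^[t+c+1]∣m n+1≡N =
      +p^[t+c]∣i*x⇒+p^t∣x (2 + t) 0 p^1∤2
        (subst (λ e → + (p ^ e) ℤ.∣ + 2 ℤ.* alternating (binom m) n) (sym (+-identityʳ (2 + t))) doubled)
      where
      p^1∤2 : p ^ 1 ∤ 2
      p^1∤2 = >⇒∤ (subst (2 <_) (sym (ℕ.*-identityʳ p)) 2<p)
      doubled : + (p ^ (2 + t)) ℤ.∣ + 2 ℤ.* alternating (binom m) n
      doubled = alternating-reflect (binom m) n (sign-pred {n} (trans (cong sign n+1≡N) (sign[p^e]≡-1 (suc c))))
        (λ i i′ k+k′≡n+1 → +p^[2+t]∣binom-pair t c i i′ (subst (λ e → p ^ e ∣ m) (+-suc t c) p^[t+c+1]∣m)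
                                                        (trans k+k′≡n+1 n+1≡N))

open import Data.Nat using (_<_; _≤_; _+_; _*_; _∸_; _^_)
open import Data.Nat.Combinatorics using (_C_)
open import Data.Integer as ℤ using (+_; -1ℤ)
open import Data.Product using (_×_; _,_)
open import Data.Nat.Properties using (m≤n⇒∃[o]m+o≡n; m+n∸m≡n)
open import Relation.Binary.PropositionalEquality using (refl)
open import Defs

module BinomialCongruences {p : ℕ} (p-prime : Prime p) (g : ℕ) where
  open import Data.Nat.Base using (zero; suc; s≤s)
  open import Data.Nat.Properties
    using (+-comm; +-suc; +-identityʳ; <⇒≤; ≤-trans; <-≤-trans; n<1+n; n≤1+n; <-cmp; +-cancelˡ-<;
           +-monoʳ-≤; +-monoʳ-<; ^-monoʳ-≤; ^-monoʳ-<)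
  open import Data.Nat.Divisibility using (_∣_; _∤_; ∣-reflexive; ∣m+n∣m⇒∣n; >⇒∤)
  open import Data.Nat.Tactic.RingSolver using (solve-∀)
  import Data.Integer.Divisibility.Signed as ℤ
  open import Relation.Binary.Definitions using (tri<; tri≈; tri>)
  open import Relation.Binary.PropositionalEquality
  open Alternating
  open Binomial
  open PrimePowers p-prime

  BinomialCongruence : ℕ → ℕ → Set
  BinomialCongruence e k = (k>0 : 0 < k) →
    CongZp p (2 * g + 2) (ℕ→ℚ ((p ^ (e + g)) C k)) (frac ((-1ℤ ℤ.^ (k ∸ 1)) ℤ.* (+ (p ^ (e + g)))) k k>0)

  congruence-via-alternating : ∀ e c t j → e + g + t ≡ 2 * g + 2 + c → p ^ suc c ∤ suc j →
    + (p ^ t) ℤ.∣ alternating (binom (p ^ (e + g))) j → BinomialCongruence e (suc j)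
  congruence-via-alternating e c t j exponent p^[c+1]∤k p^t∣A k>0 =
    congruence-from-∣ (2 * g + 2) c (q C suc j) (sign j ℤ.* + q) j k>0 p^[c+1]∤k
      (subst₂ (λ d x → + (p ^ d) ℤ.∣ x) exponent (sym ([k+1]*mC[k+1]-sign*m≡m*alternating q j))
        (+p^m∣∧+p^n∣⇒+p^[m+n]∣* (e + g) t ℤ.∣-refl p^t∣A))
    where
    q = p ^ (e + g)

  congruence-below : ∀ e {k} → k < p ^ e → BinomialCongruence e k
  congruence-below e {zero} _ ()
  congruence-below zero {suc j} (s≤s ())
  congruence-below (suc c) {suc j} k<p^[c+1] =
    congruence-via-alternating (suc c) c (suc g) j (exponent c g) (>⇒∤ k<p^[c+1])
      (+p^t∣alternating-binom (suc g) c j (∣-reflexive (cong (λ n → p ^ suc n) (+-comm g c))) (<⇒≤ k<p^[c+1]))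
    where
    exponent : ∀ c g → suc c + g + suc g ≡ 2 * g + 2 + c
    exponent = solve-∀

  congruence-at : 2 < p → ∀ e {k} → k ≡ p ^ e → BinomialCongruence e k
  congruence-at 2<p e {zero} _ ()
  congruence-at 2<p e {suc j} k≡p^e =
    congruence-via-alternating e e (2 + g) j (exponent e g)
      (>⇒∤ (subst (_< p ^ suc e) (sym k≡p^e) (^-monoʳ-< p 1<p (n<1+n e))))
      (+p^[2+t]∣alternating-binom 2<p g e (∣-reflexive (cong (p ^_) (+-comm g e))) k≡p^e)
    where
    exponent : ∀ e g → e + g + (2 + g) ≡ 2 * g + 2 + e
    exponent = solve-∀

  congruence-beyond : ∀ e r → 0 < r → r < p ^ (e ∸ 1) → BinomialCongruence e (p ^ e + r)
  congruence-beyond zero (suc o) _ (s≤s ())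
  congruence-beyond (suc zero) (suc o) _ (s≤s ())
  congruence-beyond e@(suc (suc c)) (suc o) _ r<p^[c+1] =
    subst (BinomialCongruence e) (sym (+-suc (p ^ e) o))
      (congruence-via-alternating e c g (p ^ e + o) (exponent c g) p^[c+1]∤k
        (+p^t∣alternating-binom g e (p ^ e + o) (∣-reflexive (cong (p ^_) (+-comm g e))) k<p^[e+1]))
    where
    exponent : ∀ c g → suc (suc c) + g + g ≡ 2 * g + 2 + c
    exponent = solve-∀
    p^[c+1]∤k : p ^ suc c ∤ suc (p ^ e + o)
    p^[c+1]∤k p^[c+1]∣k = >⇒∤ r<p^[c+1]
      (∣m+n∣m⇒∣n (subst (p ^ suc c ∣_) (sym (+-suc (p ^ e) o)) p^[c+1]∣k) (^-monoʳ-∣ (n≤1+n (suc c))))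
    k<p^[e+1] : p ^ e + o < p ^ suc e
    k<p^[e+1] = <-≤-trans (+-monoʳ-< (p ^ e) (<⇒≤ r<p^[c+1]))
      (≤-trans (+-monoʳ-≤ (p ^ e) (^-monoʳ-≤ p (n≤1+n (suc c)))) (p^e+p^e≤p^[e+1] e))

  congruence-near : 2 < p → ∀ e {k} → k < p ^ e + p ^ (e ∸ 1) → BinomialCongruence e k
  congruence-near 2<p e {k} k< with <-cmp k (p ^ e)
  ... | tri< k<p^e _ _ = congruence-below e k<p^e
  ... | tri≈ _ k≡p^e _ = congruence-at 2<p e k≡p^e
  ... | tri> _ _ p^e<k with m≤n⇒∃[o]m+o≡n (<⇒≤ p^e<k)
  ...   | r , refl = congruence-beyond e r r>0 (+-cancelˡ-< (p ^ e) r (p ^ (e ∸ 1)) k<)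
    where
    r>0 : 0 < r
    r>0 = +-cancelˡ-< (p ^ e) 0 r (subst (_< p ^ e + r) (sym (+-identityʳ (p ^ e))) p^e<k)

lemma6 : (p : ℕ) → Prime p → (e f : ℕ) → e ≤ f →
    ((k : ℕ) → (k>0 : 0 < k) → k < p ^ e →
      CongZp p (2 * (f ∸ e) + 2) (ℕ→ℚ ((p ^ f) C k))
        (frac ((-1ℤ ℤ.^ (k ∸ 1)) ℤ.* (+ (p ^ f))) k k>0))
    × (2 < p → e < f → (k : ℕ) → (k>0 : 0 < k) → k < p ^ e + p ^ (e ∸ 1) →
      CongZp p (2 * (f ∸ e) + 2) (ℕ→ℚ ((p ^ f) C k))
        (frac ((-1ℤ ℤ.^ (k ∸ 1)) ℤ.* (+ (p ^ f))) k k>0))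
lemma6 p p-prime e f e≤f with m≤n⇒∃[o]m+o≡n e≤f
... | g , refl rewrite m+n∸m≡n e g =
  (λ k k>0 k<p^e → congruence-below e k<p^e k>0) ,
  (λ 2<p _ k k>0 k< → congruence-near 2<p e k< k>0)
  where open BinomialCongruences p-prime g
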